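{- Let $\mathfrak X$ be a homogeneous tree of degree $q+1$ ($q\geq1$), let $k,\ell$ be integers with $2\leq k<\ell$, and let $d=\gcd(k,\ell)$. Then the snapshot $f_d$ of a wave $\{f_j\}_{j\in\mathbb Z}$ is determined by $f_0,f_k,f_\ell$: if two waves have the same snapshots at times $0,k,\ell$, then they have the same snapshot at time $d$. In particular, if $k$ and $\ell$ are relatively prime, then a wave is uniquely determined by its snapshots $f_0,f_k,f_\ell$.
   Context: $\mathfrak X$ is a tree in which every vertex has exactly $q+1$ edges; $\mathcal F(\mathfrak X)$ is the space of complex-valued functions on its vertices; $\mu_1f(v)=\frac{1}{q+1}\sum_{w\text{ adjacent to }v}f(w)$. A wave is a family $\{f_j\}_{j\in\mathbb Z}$ in $\mathcal F(\mathfrak X)$ with $\mu_1f_j=\frac{f_{j+1}+f_{j-1}}{2}$ for all $j\in\mathbb Z$; $f_j$ is its snapshot at time $j$. -}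

module Defs where

open import Level using (Level; _⊔_)
open import Data.Nat as ℕ using (ℕ; zero; suc)
open import Data.Fin using (Fin)
open import Data.Fin.Properties using (_≟_)
open import Data.List using (List; []; _∷_; foldr; map)
open import Data.List.Base using () renaming (allFin to allFinL)
open import Data.Unit using (⊤; tt)
open import Data.Product using (Σ; _,_) renaming (_×_ to _∧_)
open import Data.Integer as ℤ using (ℤ)
open import Relation.Nullary using (¬_; yes; no)
open import Relation.Nullary.Decidable using (False; fromWitnessFalse)
open import Algebra.Bundles using (CommutativeRing)

-- Scalars: a field of characteristic zero (ℂ is the intended instance;
-- agda-stdlib has no complex numbers).

ringℕ : ∀ {c ℓ} (R : CommutativeRing c ℓ) → ℕ → CommutativeRing.Carrier R
ringℕ R zero    = CommutativeRing.0# R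
ringℕ R (suc n) = CommutativeRing._+_ R (CommutativeRing.1# R) (ringℕ R n)

record Char0Field (c ℓ : Level) : Set (Level.suc (c ⊔ ℓ)) where
  field
    commRing : CommutativeRing c ℓ
  open CommutativeRing commRing public
  field
    _⁻¹     : Carrier → Carrier
    ⁻¹-inverse : ∀ x → ¬ (x ≈ 0#) → (x * (x ⁻¹)) ≈ 1#
    char0   : ∀ n → ¬ (ringℕ commRing (suc n) ≈ 0#)

-- The homogeneous tree of degree q+1: the Cayley graph of the free
-- product of q+1 copies of ℤ/2.  A vertex is a reduced word in the
-- letters Fin (q+1) (no two consecutive letters equal), stored with its
-- last letter first.

Reduced : ∀ {n} → List (Fin n) → Set
Reduced []          = ⊤
Reduced (x ∷ [])    = ⊤
Reduced (x ∷ y ∷ r) = False (x ≟ y) ∧ Reduced (y ∷ r)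

Vertex : ℕ → Set
Vertex q = Σ (List (Fin (suc q))) Reduced

reduced-tail : ∀ {n} (x : Fin n) (r : List (Fin n)) → Reduced (x ∷ r) → Reduced r
reduced-tail x []      _       = tt
reduced-tail x (y ∷ r) (_ , p) = p

-- the neighbour of v along edge label a (right multiplication by a);
-- the neighbours of v are exactly  step v a,  a : Fin (q+1)  (all distinct)
step : ∀ {q} → Vertex q → Fin (suc q) → Vertex q
step ([] , _) a = (a ∷ [] , tt)
step (x ∷ r , p) a with a ≟ x
... | yes _   = (r , reduced-tail x r p)
... | no a≢x = (a ∷ x ∷ r , fromWitnessFalse a≢x , p)

module _ {c ℓ} (K : Char0Field c ℓ) where
  open Char0Field K

  𝓕 : ℕ → Set c
  𝓕 q = Vertex q → Carrier

  μ₁ : ∀ {q} → 𝓕 q → 𝓕 q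
  μ₁ {q} f v = ((ringℕ commRing (suc q)) ⁻¹) * foldr _+_ 0# (map (λ a → f (step v a)) (allFinL (suc q)))

  IsWave : ∀ {q} → (ℤ → 𝓕 q) → Set ℓ
  IsWave {q} f = ∀ (j : ℤ) (v : Vertex q) →
    μ₁ (f j) v ≈ (f (j ℤ.+ ℤ.1ℤ) v + f (j ℤ.- ℤ.1ℤ) v) * ((ringℕ commRing 2) ⁻¹)

  _≐_ : ∀ {q} → 𝓕 q → 𝓕 q → Set ℓ
  f ≐ g = ∀ v → f v ≈ g v

-- The times at which two waves f and g agree form a set containing 0 that is closed
-- under the reflection r ↦ 2a − r about each of its points a.  Indeed j ↦ f_{a+j} + f_{a−j}
-- is again a wave; it agrees with its g-counterpart at j = 0, and at j = 1 too, where both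
-- equal 2 μ₁ f_a = 2 μ₁ g_a; and two waves agreeing at two consecutive times agree
-- everywhere.  A set of naturals closed under (m, n) ↦ |2m − n| is closed under gcd, by a
-- Euclid-type descent (for 0 < m < n, |2m − n| < n and gcd(m, |2m − n|) = gcd(m, n)).  So f
-- and g agree at gcd(k, l), and when this is 1 they agree at 0 and 1, hence everywhere.

{-# OPTIONS --safe #-}
module Submission where

open import Defs
open import Level using (Level)
open import Data.Nat using (ℕ; _≤_; _<_)
open import Data.Nat.GCD using (gcd)
open import Data.Nat.Coprimality using (Coprime)
open import Data.Integer using (ℤ; +_)
open import Data.Product using (_×_)

open import Algebra.Bundles using (AbelianGroup; CommutativeMonoid)
import Algebra.Construct.Pointwise as Pointwise
open import Algebra.Morphism.Structures using (module MagmaMorphisms)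
import Algebra.Properties.AbelianGroup as AbelianGroupProperties
import Algebra.Properties.CommutativeSemigroup as CommutativeSemigroupProperties
open import Data.Fin using (Fin)
open import Data.List using (List; []; _∷_; foldr; map)
open import Data.List.Base using () renaming (allFin to allFinL)
open import Data.Nat.Base as ℕ using (zero; suc; ∣_-_∣; z<s)
import Data.Nat.Properties as ℕ
open import Data.Nat.Divisibility
  using (_∣_; ∣-refl; ∣-antisym; ∣m∣n⇒∣m+n; ∣m+n∣m⇒∣n)
open import Data.Nat.GCD using (gcd[m,n]∣m; gcd[m,n]∣n; gcd-greatest; gcd-comm; gcd-identityˡ)
open import Data.Nat.Coprimality using (coprime⇒gcd≡1)
open import Data.Nat.Induction using (<-rec)
open import Data.Integer.Base as Int using (0ℤ; 1ℤ; _⊖_; -[1+_])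
open import Data.Integer.Properties
  using ( +-assoc; +-identityˡ; +-identityʳ; neg-distrib-+; +∣i∣≡i⊎+∣i∣≡-i
        ; [+m]-[+n]≡m⊖n; [1+m]⊖[1+n]≡m⊖n )
open import Data.Integer.Tactic.RingSolver using (solve-∀)
open import Data.Product using (_,_; proj₁)
open import Data.Sum using (_⊎_; inj₁; inj₂)
open import Relation.Binary.PropositionalEquality as ≡
  using (_≡_; cong; cong₂; subst; module ≡-Reasoning)

m+∣m-n∣≡n⊎n+∣m-n∣≡m : ∀ m n → m ℕ.+ ∣ m - n ∣ ≡ n ⊎ n ℕ.+ ∣ m - n ∣ ≡ m
m+∣m-n∣≡n⊎n+∣m-n∣≡m m n with ℕ.≤-total m n
... | inj₁ m≤n = inj₁ (≡.trans (cong (m ℕ.+_) (ℕ.m≤n⇒∣m-n∣≡n∸m m≤n)) (ℕ.m+[n∸m]≡n m≤n))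
... | inj₂ n≤m = inj₂ (≡.trans (cong (n ℕ.+_) (ℕ.m≤n⇒∣n-m∣≡n∸m n≤m)) (ℕ.m+[n∸m]≡n n≤m))

∣m∣n⇒∣∣m-n∣ : ∀ {d m n} → d ∣ m → d ∣ n → d ∣ ∣ m - n ∣
∣m∣n⇒∣∣m-n∣ {d} {m} {n} d∣m d∣n with m+∣m-n∣≡n⊎n+∣m-n∣≡m m n
... | inj₁ eq = ∣m+n∣m⇒∣n (subst (d ∣_) (≡.sym eq) d∣n) d∣m
... | inj₂ eq = ∣m+n∣m⇒∣n (subst (d ∣_) (≡.sym eq) d∣m) d∣n

∣m∣∣m-n∣⇒∣n : ∀ {d m n} → d ∣ m → d ∣ ∣ m - n ∣ → d ∣ n
∣m∣∣m-n∣⇒∣n {d} {m} {n} d∣m d∣∣m-n∣ with m+∣m-n∣≡n⊎n+∣m-n∣≡m m n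
... | inj₁ eq = subst (d ∣_) eq (∣m∣n⇒∣m+n d∣m d∣∣m-n∣)
... | inj₂ eq =
  ∣m+n∣m⇒∣n (subst (d ∣_) (≡.sym (≡.trans (ℕ.+-comm ∣ m - n ∣ n) eq)) d∣m) d∣∣m-n∣

gcd[n,n]≡n : ∀ n → gcd n n ≡ n
gcd[n,n]≡n n = ∣-antisym (gcd[m,n]∣m n n) (gcd-greatest ∣-refl ∣-refl)

gcd[m,∣m+m-n∣]≡gcd[m,n] : ∀ m n → gcd m ∣ m ℕ.+ m - n ∣ ≡ gcd m n
gcd[m,∣m+m-n∣]≡gcd[m,n] m n = ∣-antisym
  (gcd-greatest d∣m (∣m∣∣m-n∣⇒∣n (∣m∣n⇒∣m+n d∣m d∣m) (gcd[m,n]∣n m ∣ m ℕ.+ m - n ∣)))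
  (gcd-greatest e∣m (∣m∣n⇒∣∣m-n∣ (∣m∣n⇒∣m+n e∣m e∣m) (gcd[m,n]∣n m n)))
  where
  d∣m : gcd m ∣ m ℕ.+ m - n ∣ ∣ m
  d∣m = gcd[m,n]∣m m ∣ m ℕ.+ m - n ∣
  e∣m : gcd m n ∣ m
  e∣m = gcd[m,n]∣m m n

∣m+m-n∣<n : ∀ {m n} → 0 < m → m < n → ∣ m ℕ.+ m - n ∣ < n
∣m+m-n∣<n {m} {n} 0<m m<n with ℕ.≤-total (m ℕ.+ m) n
... | inj₁ 2m≤n = subst (_< n) (≡.sym (ℕ.m≤n⇒∣m-n∣≡n∸m 2m≤n))
                    (ℕ.∸-monoʳ-< (ℕ.+-mono-< 0<m 0<m) 2m≤n)
... | inj₂ n≤2m = subst (_< n) (≡.sym (ℕ.m≤n⇒∣n-m∣≡n∸m n≤2m))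
                    (ℕ.m<n+o⇒m∸n<o (m ℕ.+ m) n {{ℕ.>-nonZero (ℕ.m<n⇒0<n m<n)}}
                      (ℕ.+-mono-< m<n m<n))

module ReflectionClosedℕ {p} {P : ℕ → Set p}
  (reflect : ∀ {m n} → P m → P n → P ∣ m ℕ.+ m - n ∣) where

  gcd-closed-≤ : ∀ n {m} → m ≤ n → P m → P n → P (gcd m n)
  gcd-closed-≤ = <-rec _ descend
    where
    descend : ∀ n → (∀ {n′} → n′ < n → ∀ {m} → m ≤ n′ → P m → P n′ → P (gcd m n′)) →
           ∀ {m} → m ≤ n → P m → P n → P (gcd m n)
    descend n rec {zero} _ _ pn = subst P (≡.sym (gcd-identityˡ n)) pn
    descend n rec {m@(suc _)} m≤n pm pn with ℕ.m≤n⇒m<n∨m≡n m≤n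
    ... | inj₂ ≡.refl = subst P (≡.sym (gcd[n,n]≡n n)) pm
    ... | inj₁ m<n = subst P (gcd[m,∣m+m-n∣]≡gcd[m,n] m n) (by-size (ℕ.≤-total m r))
      where
      r : ℕ
      r = ∣ m ℕ.+ m - n ∣
      pr : P r
      pr = reflect pm pn
      by-size : m ≤ r ⊎ r ≤ m → P (gcd m r)
      by-size (inj₁ m≤r) = rec (∣m+m-n∣<n z<s m<n) m≤r pm pr
      by-size (inj₂ r≤m) = subst P (gcd-comm r m) (rec m<n r≤m pr pm)

  gcd-closed : ∀ {m n} → P m → P n → P (gcd m n)
  gcd-closed {m} {n} pm pn with ℕ.≤-total m n
  ... | inj₁ m≤n = gcd-closed-≤ n m≤n pm pn
  ... | inj₂ n≤m = subst P (gcd-comm n m) (gcd-closed-≤ m n≤m pn pm)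

∣m⊖n∣≡∣m-n∣ : ∀ m n → Int.∣ m ⊖ n ∣ ≡ ∣ m - n ∣
∣m⊖n∣≡∣m-n∣ zero    zero    = ≡.refl
∣m⊖n∣≡∣m-n∣ zero    (suc n) = ≡.refl
∣m⊖n∣≡∣m-n∣ (suc m) zero    = ≡.refl
∣m⊖n∣≡∣m-n∣ (suc m) (suc n) = ≡.trans (cong Int.∣_∣ ([1+m]⊖[1+n]≡m⊖n m n)) (∣m⊖n∣≡∣m-n∣ m n)

module ReflectionClosedℤ {p} {S : ℤ → Set p} (0∈S : S 0ℤ)
  (reflect : ∀ {a r} → S a → S r → S (a Int.+ (a Int.- r))) where
  open Int using (_+_; _-_; -_)

  neg-closed : ∀ {r} → S r → S (- r)
  neg-closed {r} sr =
    subst S (≡.trans (+-identityˡ (0ℤ - r)) (+-identityˡ (- r))) (reflect 0∈S sr)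

  abs-closed : ∀ {i} → S i → S (+ Int.∣ i ∣)
  abs-closed {i} si with +∣i∣≡i⊎+∣i∣≡-i i
  ... | inj₁ eq = subst S (≡.sym eq) si
  ... | inj₂ eq = subst S (≡.sym eq) (neg-closed si)

  reflect-ℕ : ∀ {m n} → S (+ m) → S (+ n) → S (+ ∣ m ℕ.+ m - n ∣)
  reflect-ℕ {m} {n} sm sn = subst S (cong +_ ∣2m-n∣) (abs-closed (reflect sm sn))
    where
    open ≡-Reasoning
    ∣2m-n∣ : Int.∣ + m + (+ m - + n) ∣ ≡ ∣ m ℕ.+ m - n ∣
    ∣2m-n∣ = begin
      Int.∣ + m + (+ m - + n) ∣   ≡⟨ cong Int.∣_∣ (≡.sym (+-assoc (+ m) (+ m) (- + n))) ⟩
      Int.∣ + (m ℕ.+ m) - + n ∣   ≡⟨ cong Int.∣_∣ ([+m]-[+n]≡m⊖n (m ℕ.+ m) n) ⟩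
      Int.∣ (m ℕ.+ m) ⊖ n ∣       ≡⟨ ∣m⊖n∣≡∣m-n∣ (m ℕ.+ m) n ⟩
      ∣ m ℕ.+ m - n ∣           ∎

  gcd-closed : ∀ {m n} → S (+ m) → S (+ n) → S (+ gcd m n)
  gcd-closed = ReflectionClosedℕ.gcd-closed {P = λ n → S (+ n)} reflect-ℕ

module _ where
  open Int using (_+_; _-_)

  i+1-1≡i : ∀ i → i + 1ℤ - 1ℤ ≡ i
  i+1-1≡i = solve-∀

  i-1+1≡i : ∀ i → i - 1ℤ + 1ℤ ≡ i
  i-1+1≡i = solve-∀

  i-[i-j]≡j : ∀ i j → i - (i - j) ≡ j
  i-[i-j]≡j = solve-∀

  ℤ-induction : ∀ {p} (P : ℤ → Set p) → P 0ℤ →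
    (∀ i → P i → P (i + 1ℤ)) → (∀ i → P i → P (i - 1ℤ)) → ∀ i → P i
  ℤ-induction P P₀ up down (+ zero)     = P₀
  ℤ-induction P P₀ up down (+ suc n)    =
    subst P (cong +_ (ℕ.+-comm n 1)) (up (+ n) (ℤ-induction P P₀ up down (+ n)))
  ℤ-induction P P₀ up down -[1+ zero ]  = down 0ℤ P₀
  ℤ-induction P P₀ up down -[1+ suc n ] =
    subst P (cong (λ k → -[1+ suc k ]) (ℕ.+-identityʳ n))
      (down -[1+ n ] (ℤ-induction P P₀ up down -[1+ n ]))

module WaveEquation {a ℓ} (G : AbelianGroup a ℓ)
  {T : AbelianGroup.Carrier G → AbelianGroup.Carrier G}
  (T-homo : MagmaMorphisms.IsMagmaHomomorphism (AbelianGroup.rawMagma G) (AbelianGroup.rawMagma G) T)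
  where
  open AbelianGroup G hiding (_-_)
  open Int using (_+_; _-_; -_)
  open AbelianGroupProperties G using (∙-cancelˡ; ∙-cancelʳ)
  open CommutativeSemigroupProperties commutativeSemigroup using (interchange)
  open MagmaMorphisms.IsMagmaHomomorphism T-homo using (⟦⟧-cong; homo)
  open import Relation.Binary.Reasoning.Setoid setoid

  ∙-cancelʳ-≈ : ∀ {x x′ y y′} → x ∙ y ≈ x′ ∙ y′ → y ≈ y′ → x ≈ x′
  ∙-cancelʳ-≈ {x} {x′} {y} {y′} eq y≈y′ = ∙-cancelʳ y x x′ (trans eq (∙-congˡ (sym y≈y′)))

  ∙-cancelˡ-≈ : ∀ {x x′ y y′} → x ∙ y ≈ x′ ∙ y′ → x ≈ x′ → y ≈ y′
  ∙-cancelˡ-≈ {x} {x′} {y} {y′} eq x≈x′ = ∙-cancelˡ x y y′ (trans eq (∙-congʳ (sym x≈x′)))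

  IsSolution : (ℤ → Carrier) → Set ℓ
  IsSolution s = ∀ j → s (j + 1ℤ) ∙ s (j - 1ℤ) ≈ T (s j)

  ∙-isSolution : ∀ {s t} → IsSolution s → IsSolution t → IsSolution (λ j → s j ∙ t j)
  ∙-isSolution {s} {t} s-sol t-sol j = begin
    (s (j + 1ℤ) ∙ t (j + 1ℤ)) ∙ (s (j - 1ℤ) ∙ t (j - 1ℤ))
      ≈⟨ interchange _ _ _ _ ⟩
    (s (j + 1ℤ) ∙ s (j - 1ℤ)) ∙ (t (j + 1ℤ) ∙ t (j - 1ℤ))
      ≈⟨ ∙-cong (s-sol j) (t-sol j) ⟩
    T (s j) ∙ T (t j)
      ≈⟨ homo (s j) (t j) ⟨
    T (s j ∙ t j) ∎

  shift-isSolution : ∀ {s} a → IsSolution s → IsSolution (λ j → s (a + j))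
  shift-isSolution {s} a s-sol j = begin
    s (a + (j + 1ℤ)) ∙ s (a + (j - 1ℤ))
      ≡⟨ cong₂ (λ i i′ → s i ∙ s i′) (≡.sym (+-assoc a j 1ℤ)) (≡.sym (+-assoc a j (- 1ℤ))) ⟩
    s ((a + j) + 1ℤ) ∙ s ((a + j) - 1ℤ)
      ≈⟨ s-sol (a + j) ⟩
    T (s (a + j)) ∎

  reverse-isSolution : ∀ {s} → IsSolution s → IsSolution (λ j → s (- j))
  reverse-isSolution {s} s-sol j = begin
    s (- (j + 1ℤ)) ∙ s (- (j - 1ℤ))
      ≡⟨ cong₂ (λ i i′ → s i ∙ s i′) (neg-distrib-+ j 1ℤ) (neg-distrib-+ j (- 1ℤ)) ⟩
    s (- j - 1ℤ) ∙ s (- j + 1ℤ)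
      ≈⟨ comm _ _ ⟩
    s (- j + 1ℤ) ∙ s (- j - 1ℤ)
      ≈⟨ s-sol (- j) ⟩
    T (s (- j)) ∎

  module Agreement {s t} (s-sol : IsSolution s) (t-sol : IsSolution t) where

    reindex : ∀ {i j} → i ≡ j → s i ≈ t i → s j ≈ t j
    reindex ≡.refl e = e

    neighbour-sums-agree : ∀ {j} → s j ≈ t j →
      s (j + 1ℤ) ∙ s (j - 1ℤ) ≈ t (j + 1ℤ) ∙ t (j - 1ℤ)
    neighbour-sums-agree {j} e = trans (s-sol j) (trans (⟦⟧-cong e) (sym (t-sol j)))

    agree-everywhere : s 0ℤ ≈ t 0ℤ → s 1ℤ ≈ t 1ℤ → ∀ j → s j ≈ t j
    agree-everywhere e₀ e₁ j = proj₁ (ℤ-induction Agree₂ (e₀ , e₁) up down j)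
      where
      Agree₂ : ℤ → Set ℓ
      Agree₂ j = s j ≈ t j × s (j + 1ℤ) ≈ t (j + 1ℤ)
      up : ∀ j → Agree₂ j → Agree₂ (j + 1ℤ)
      up j (e , e′) =
        e′ , ∙-cancelʳ-≈ (neighbour-sums-agree e′) (reindex (≡.sym (i+1-1≡i j)) e)
      down : ∀ j → Agree₂ j → Agree₂ (j - 1ℤ)
      down j (e , e′) =
        ∙-cancelˡ-≈ (neighbour-sums-agree e) e′ , reindex (≡.sym (i-1+1≡i j)) e

  agree-reflect : ∀ {s t} → IsSolution s → IsSolution t →
    ∀ {a r} → s a ≈ t a → s r ≈ t r → s (a + (a - r)) ≈ t (a + (a - r))
  agree-reflect {s} {t} s-sol t-sol {a} {r} eₐ eᵣ =
    ∙-cancelʳ-≈ (U.agree-everywhere u₀ (S.neighbour-sums-agree eₐ) (a - r))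
                (S.reindex (≡.sym (i-[i-j]≡j a r)) eᵣ)
    where
    module S = Agreement s-sol t-sol
    reflected : ∀ {w} → IsSolution w → IsSolution (λ j → w (a + j) ∙ w (a - j))
    reflected w-sol =
      ∙-isSolution (shift-isSolution a w-sol) (reverse-isSolution (shift-isSolution a w-sol))
    module U = Agreement (reflected s-sol) (reflected t-sol)
    u₀ : s (a + 0ℤ) ∙ s (a - 0ℤ) ≈ t (a + 0ℤ) ∙ t (a - 0ℤ)
    u₀ = ∙-cong (S.reindex (≡.sym (+-identityʳ a)) eₐ) (S.reindex (≡.sym (+-identityʳ a)) eₐ)

module ListSum {c ℓ} (M : CommutativeMonoid c ℓ) {a} {A : Set a} where
  open CommutativeMonoid M
  open CommutativeSemigroupProperties commutativeSemigroup using (interchange)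

  sumMap : (A → Carrier) → List A → Carrier
  sumMap φ xs = foldr _∙_ ε (map φ xs)

  sumMap-cong : ∀ {φ ψ : A → Carrier} → (∀ x → φ x ≈ ψ x) →
    ∀ xs → sumMap φ xs ≈ sumMap ψ xs
  sumMap-cong φ≈ψ []       = refl
  sumMap-cong φ≈ψ (x ∷ xs) = ∙-cong (φ≈ψ x) (sumMap-cong φ≈ψ xs)

  sumMap-∙ : ∀ (φ ψ : A → Carrier) →
    ∀ xs → sumMap (λ x → φ x ∙ ψ x) xs ≈ sumMap φ xs ∙ sumMap ψ xs
  sumMap-∙ φ ψ []       = sym (identityˡ ε)
  sumMap-∙ φ ψ (x ∷ xs) = trans (∙-congˡ (sumMap-∙ φ ψ xs)) (interchange _ _ _ _)

module TreeWaves {c ℓ} (K : Char0Field c ℓ) (q : ℕ) where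
  open Char0Field K
  open ListSum +-commutativeMonoid using (sumMap-cong; sumMap-∙)
  open CommutativeSemigroupProperties *-commutativeSemigroup using (x∙yz≈y∙xz)
  open import Relation.Binary.Reasoning.Setoid setoid

  functionGroup : AbelianGroup c ℓ
  functionGroup = Pointwise.abelianGroup (Vertex q) +-abelianGroup

  open AbelianGroup functionGroup using (rawMagma)
  open MagmaMorphisms rawMagma rawMagma using (IsMagmaHomomorphism)

  two : Carrier
  two = ringℕ commRing 2

  twice-μ₁ : 𝓕 K q → 𝓕 K q
  twice-μ₁ f v = two * μ₁ K f v

  twice-μ₁-isHomomorphism : IsMagmaHomomorphism twice-μ₁
  twice-μ₁-isHomomorphism = record
    { isRelHomomorphism = record
      { cong = λ f≐g v → *-congˡ (*-congˡ (sumMap-cong (λ a → f≐g (step v a)) neighbours)) }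
    ; homo = λ f g v →
        trans (*-congˡ (trans (*-congˡ (sumMap-∙ _ _ neighbours)) (distribˡ _ _ _)))
              (distribˡ _ _ _)
    }
    where
    neighbours : List (Fin (suc q))
    neighbours = allFinL (suc q)

  open WaveEquation functionGroup twice-μ₁-isHomomorphism using (IsSolution)

  isWave⇒isSolution : ∀ {f} → IsWave K f → IsSolution f
  isWave⇒isSolution {f} f-wave j v = begin
    neighbour-sum                        ≈⟨ *-identityʳ _ ⟨
    neighbour-sum * 1#                   ≈⟨ *-congˡ (⁻¹-inverse two (char0 1)) ⟨
    neighbour-sum * (two * two ⁻¹)       ≈⟨ x∙yz≈y∙xz _ _ _ ⟩
    two * (neighbour-sum * two ⁻¹)       ≈⟨ *-congˡ (f-wave j v) ⟨
    two * μ₁ K (f j) v                   ∎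
    where
    neighbour-sum : Carrier
    neighbour-sum = f (j Int.+ 1ℤ) v + f (j Int.- 1ℤ) v

theorem5p2 : ∀ {c ℓ : Level} (K : Char0Field c ℓ) (q : ℕ) → 1 ≤ q →
    (k l : ℕ) → 2 ≤ k → k < l →
    (f g : ℤ → 𝓕 K q) → IsWave K f → IsWave K g →
    _≐_ K (f (+ 0)) (g (+ 0)) → _≐_ K (f (+ k)) (g (+ k)) → _≐_ K (f (+ l)) (g (+ l)) →
    _≐_ K (f (+ gcd k l)) (g (+ gcd k l))
      × (Coprime k l → ∀ (j : ℤ) → _≐_ K (f j) (g j))
theorem5p2 K q _ k l _ _ f g f-wave g-wave f₀≐g₀ fₖ≐gₖ fₗ≐gₗ =
  f≐g-at-gcd , λ k⊥l → agree-everywhere f₀≐g₀ (agree-at-1 k⊥l)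
  where
  open TreeWaves K q
  open WaveEquation functionGroup twice-μ₁-isHomomorphism
  f-sol : IsSolution f
  f-sol = isWave⇒isSolution {f} f-wave
  g-sol : IsSolution g
  g-sol = isWave⇒isSolution {g} g-wave
  open Agreement {f} {g} f-sol g-sol using (agree-everywhere)
  open ReflectionClosedℤ {S = λ j → _≐_ K (f j) (g j)} f₀≐g₀
    (agree-reflect {f} {g} f-sol g-sol) using (gcd-closed)

  f≐g-at-gcd : _≐_ K (f (+ gcd k l)) (g (+ gcd k l))
  f≐g-at-gcd = gcd-closed fₖ≐gₖ fₗ≐gₗ

  agree-at-1 : Coprime k l → _≐_ K (f 1ℤ) (g 1ℤ)
  agree-at-1 k⊥l = subst (λ d → _≐_ K (f (+ d)) (g (+ d))) (coprime⇒gcd≡1 k⊥l) f≐g-at-gcd
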